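{- $\gamma_{2D}$ is not monotone: there exist a square matrix $M$ and a square submatrix $M'$ of $M$ such that $\gamma_{2D}(M') > \gamma_{2D}(M)$.
   Context: For $M\in\Sigma^{n\times n}$, $M[i:i+a-1][j:j+b-1]$ denotes the $a\times b$ submatrix with rows $i,\dots,i+a-1$ and columns $j,\dots,j+b-1$. An occurrence of an $\ell\times\ell$ matrix $I$ in $M$ is a position $(i',j')$ with $M[i':i'+\ell-1][j':j'+\ell-1]=I$; it crosses position $p=(a,b)$ if $i'\le a\le i'+\ell-1$ and $j'\le b\le j'+\ell-1$. A two-dimensional attractor for $M$ is a set $\Gamma_{2D}\subseteq\{1,\dots,n\}\times\{1,\dots,n\}$ such that every square submatrix of $M$ has an occurrence crossing some position of $\Gamma_{2D}$; $\gamma_{2D}(M)$ is the minimum cardinality of such an attractor. A measure is monotone if its value on any square submatrix of $M$ is at most its value on $M$. -}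

module Defs where

open import Data.Nat using (ℕ; _+_; _≤_; _<_)
open import Data.Fin using (Fin)
open import Data.Product using (_×_; _,_; Σ; ∃; ∃-syntax)
open import Data.List using (List; length)
open import Data.List.Membership.Propositional using (_∈_)
open import Relation.Binary.PropositionalEquality using (_≡_)

-- Convention: 0-indexed positions. An n×n matrix over the alphabet Fin k
-- is represented by a function ℕ → ℕ → Fin k of which only the entries
-- (a , b) with a < n and b < n are ever inspected (all definitions below
-- only look at in-range entries).
Mat : ℕ → Set
Mat k = ℕ → ℕ → Fin k

InRange : ℕ → ℕ → ℕ → ℕ → Set
InRange n i j ℓ = (i + ℓ ≤ n) × (j + ℓ ≤ n)

SameSquare : ∀ {k} → Mat k → ℕ → ℕ → ℕ → ℕ → ℕ → Set
SameSquare M ℓ i j i' j' =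
  ∀ a b → a < ℓ → b < ℓ → M (i + a) (j + b) ≡ M (i' + a) (j' + b)

Crosses : ℕ → ℕ → ℕ → ℕ × ℕ → Set
Crosses ℓ i' j' (a , b) = (i' ≤ a) × (a < i' + ℓ) × (j' ≤ b) × (b < j' + ℓ)

IsAttractor2D : ∀ {k} → ℕ → Mat k → List (ℕ × ℕ) → Set
IsAttractor2D n M Γ =
  (∀ {a b} → (a , b) ∈ Γ → (a < n) × (b < n)) ×
  (∀ ℓ i j → 1 ≤ ℓ → InRange n i j ℓ →
     ∃[ i' ] ∃[ j' ] (InRange n i' j' ℓ × SameSquare M ℓ i j i' j' ×
       ∃[ p ] (p ∈ Γ × Crosses ℓ i' j' p)))

-- γ2D(M) = g : g is the minimum cardinality of a 2D attractor of M.
-- (A minimum-length list attractor has no duplicates, so minimising over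
-- lists gives the same value as minimising over sets.)
IsGamma2D : ∀ {k} → ℕ → Mat k → ℕ → Set
IsGamma2D n M g =
  (∃[ Γ ] (IsAttractor2D n M Γ × length Γ ≡ g)) ×
  (∀ Γ → IsAttractor2D n M Γ → g ≤ length Γ)

SubMat : ∀ {k} → Mat k → ℕ → ℕ → Mat k
SubMat M i j a b = M (i + a) (j + b)

-- M₀ below is a 5×5 binary matrix with a 2D attractor of size 2 whose 4×4
-- submatrix at (0 , 1) needs 3 positions.  Every property involved ranges
-- over finitely many sizes, positions and occurrences, hence is decidable,
-- and the type checker runs the decisions.  For the lower bounds it suffices
-- to rule out every shorter list of positions already on the squares of side
-- at most L (L = 1 for M₀, where both symbols occur; L = 2 for the submatrix),
-- which keeps the search small.
module Submission where

open import Defs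
open import Data.Nat using (ℕ; zero; suc; _+_; _≤_; _<_; s≤s; z≤n; _≤?_; _<?_)
open import Data.Nat.Properties
  using (≤-trans; ≤-<-trans; m<m+n; m≤n+m; n≮n; +-identityʳ; ≮⇒≥; allUpTo?; anyUpTo?)
open import Data.Fin using (Fin; #_)
open import Data.Fin.Properties using () renaming (_≟_ to _≟ᶠ_)
open import Data.Product using (_×_; _,_; Σ; ∃-syntax; proj₁)
open import Data.List using (List; []; _∷_; length; head; drop)
open import Data.List.Membership.Propositional using (_∈_; find; lose)
open import Data.List.Relation.Unary.Any using (Any; any?)
open import Data.List.Relation.Unary.All using (All; []; _∷_)
import Data.List.Relation.Unary.All as All
open import Data.Maybe using (fromMaybe)
open import Function using (_∘_)
open import Relation.Nullary using (Dec; ¬_; contradiction)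
open import Relation.Nullary.Decidable using (map′; _×-dec_; _→-dec_; ¬?; from-yes)
open import Relation.Binary.PropositionalEquality using (refl; subst)

InBounds : ℕ → ℕ × ℕ → Set
InBounds n (a , b) = a < n × b < n

CrossedOccurrence : ∀ {k} → ℕ → Mat k → List (ℕ × ℕ) → ℕ → ℕ → ℕ → Set
CrossedOccurrence n M Γ ℓ i j =
  ∃[ i' ] ∃[ j' ] (InRange n i' j' ℓ × SameSquare M ℓ i j i' j' ×
    ∃[ p ] (p ∈ Γ × Crosses ℓ i' j' p))

AttractsUpTo : ∀ {k} → ℕ → ℕ → Mat k → List (ℕ × ℕ) → Set
AttractsUpTo L n M Γ =
  ∀ ℓ i j → 1 ≤ ℓ → ℓ ≤ L → InRange n i j ℓ → CrossedOccurrence n M Γ ℓ i j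

start<size : ∀ {i ℓ n} → 1 ≤ ℓ → i + ℓ ≤ n → i < n
start<size {i} 1≤ℓ i+ℓ≤n = ≤-trans (m<m+n i 1≤ℓ) i+ℓ≤n

side≤size : ∀ {i ℓ n} → i + ℓ ≤ n → ℓ ≤ n
side≤size {i} {ℓ} i+ℓ≤n = ≤-trans (m≤n+m ℓ i) i+ℓ≤n

attractor⇒attractsUpTo : ∀ {k} L n (M : Mat k) Γ →
  IsAttractor2D n M Γ → AttractsUpTo L n M Γ
attractor⇒attractsUpTo L n M Γ (_ , attracts) ℓ i j 1≤ℓ _ = attracts ℓ i j 1≤ℓ

attractsUpTo⇒attractor : ∀ {k} n (M : Mat k) Γ →
  All (InBounds n) Γ → AttractsUpTo n n M Γ → IsAttractor2D n M Γ
attractsUpTo⇒attractor n M Γ inBounds attracts =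
  All.lookup inBounds ,
  λ ℓ i j 1≤ℓ range → attracts ℓ i j 1≤ℓ (side≤size (proj₁ range)) range

inBounds? : ∀ n p → Dec (InBounds n p)
inBounds? n (a , b) = a <? n ×-dec b <? n

inRange? : ∀ n i j ℓ → Dec (InRange n i j ℓ)
inRange? n i j ℓ = i + ℓ ≤? n ×-dec j + ℓ ≤? n

crosses? : ∀ ℓ i' j' p → Dec (Crosses ℓ i' j' p)
crosses? ℓ i' j' (a , b) = i' ≤? a ×-dec a <? i' + ℓ ×-dec j' ≤? b ×-dec b <? j' + ℓ

sameSquare? : ∀ {k} (M : Mat k) ℓ i j i' j' → Dec (SameSquare M ℓ i j i' j')
sameSquare? M ℓ i j i' j' =
  map′ (λ same a b a<ℓ b<ℓ → same {a} a<ℓ {b} b<ℓ) (λ same {a} a<ℓ {b} b<ℓ → same a b a<ℓ b<ℓ)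
    (allUpTo? (λ a → allUpTo? (λ b → M (i + a) (j + b) ≟ᶠ M (i' + a) (j' + b)) ℓ) ℓ)

crosses⇒nonempty : ∀ ℓ i' j' p → Crosses ℓ i' j' p → 1 ≤ ℓ
crosses⇒nonempty zero i' _ _ (i'≤a , a<i'+0 , _) =
  contradiction (≤-<-trans i'≤a (subst (_ <_) (+-identityʳ i') a<i'+0)) (n≮n i')
crosses⇒nonempty (suc ℓ) _ _ _ _ = s≤s z≤n

crossedOccurrence? : ∀ {k} n (M : Mat k) Γ ℓ i j → Dec (CrossedOccurrence n M Γ ℓ i j)
crossedOccurrence? n M Γ ℓ i j = map′ unbound bound
  (anyUpTo? (λ i' → anyUpTo? (λ j' →
     inRange? n i' j' ℓ ×-dec sameSquare? M ℓ i j i' j' ×-dec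
     any? (crosses? ℓ i' j') Γ) n) n)
  where
  Candidate : ℕ → ℕ → Set
  Candidate i' j' = InRange n i' j' ℓ × SameSquare M ℓ i j i' j' × Any (Crosses ℓ i' j') Γ

  unbound : ∃[ i' ] (i' < n × ∃[ j' ] (j' < n × Candidate i' j')) →
            CrossedOccurrence n M Γ ℓ i j
  unbound (i' , _ , j' , _ , range , same , crossing) = i' , j' , range , same , find crossing

  bound : CrossedOccurrence n M Γ ℓ i j →
          ∃[ i' ] (i' < n × ∃[ j' ] (j' < n × Candidate i' j'))
  bound (i' , j' , range@(ri , rj) , same , p , p∈Γ , crossing) =
    i' , start<size 1≤ℓ ri , j' , start<size 1≤ℓ rj , range , same , lose p∈Γ crossing
    where 1≤ℓ = crosses⇒nonempty ℓ i' j' p crossing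

attractsUpTo? : ∀ {k} L n (M : Mat k) Γ → Dec (AttractsUpTo L n M Γ)
attractsUpTo? L n M Γ = map′ unbound bound
  (allUpTo? (λ ℓ → allUpTo? (λ i → allUpTo? (λ j →
     (0 <? ℓ ×-dec inRange? n i j ℓ) →-dec crossedOccurrence? n M Γ ℓ i j) n) n) (suc L))
  where
  unbound : (∀ {ℓ} → ℓ < suc L → ∀ {i} → i < n → ∀ {j} → j < n →
              1 ≤ ℓ × InRange n i j ℓ → CrossedOccurrence n M Γ ℓ i j) →
            AttractsUpTo L n M Γ
  unbound attracts ℓ i j 1≤ℓ ℓ≤L range@(ri , rj) =
    attracts (s≤s ℓ≤L) (start<size 1≤ℓ ri) (start<size 1≤ℓ rj) (1≤ℓ , range)

  bound : AttractsUpTo L n M Γ →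
          ∀ {ℓ} → ℓ < suc L → ∀ {i} → i < n → ∀ {j} → j < n →
          1 ≤ ℓ × InRange n i j ℓ → CrossedOccurrence n M Γ ℓ i j
  bound attracts {ℓ} (s≤s ℓ≤L) {i} _ {j} _ (1≤ℓ , range) = attracts ℓ i j 1≤ℓ ℓ≤L range

ForAllPositionLists : ℕ → ℕ → (List (ℕ × ℕ) → Set) → Set
ForAllPositionLists n zero P = P []
ForAllPositionLists n (suc m) P =
  ∀ {a} → a < n → ∀ {b} → b < n → ForAllPositionLists n m (P ∘ ((a , b) ∷_))

forAllPositionLists? : ∀ n m {P : List (ℕ × ℕ) → Set} → (∀ Γ → Dec (P Γ)) →
  Dec (ForAllPositionLists n m P)
forAllPositionLists? n zero P? = P? []
forAllPositionLists? n (suc m) P? =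
  allUpTo? (λ a → allUpTo? (λ b → forAllPositionLists? n m (P? ∘ ((a , b) ∷_))) n) n

forAllPositionLists-elim : ∀ n {P : List (ℕ × ℕ) → Set} Γ →
  ForAllPositionLists n (length Γ) P → All (InBounds n) Γ → P Γ
forAllPositionLists-elim n [] holds [] = holds
forAllPositionLists-elim n (_ ∷ Γ) holds ((a<n , b<n) ∷ inBounds) =
  forAllPositionLists-elim n Γ (holds a<n b<n) inBounds

NoAttractorShorterThan : ∀ {k} → ℕ → ℕ → Mat k → ℕ → Set
NoAttractorShorterThan L n M g =
  ∀ {m} → m < g → ForAllPositionLists n m (¬_ ∘ AttractsUpTo L n M)

noAttractorShorterThan? : ∀ {k} L n (M : Mat k) g → Dec (NoAttractorShorterThan L n M g)
noAttractorShorterThan? L n M =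
  allUpTo? (λ m → forAllPositionLists? n m (¬? ∘ attractsUpTo? L n M))

attractor-length-≥ : ∀ {k} L n (M : Mat k) g → NoAttractorShorterThan L n M g →
  ∀ Γ → IsAttractor2D n M Γ → g ≤ length Γ
attractor-length-≥ L n M g none Γ attractor@(inBounds , _) = ≮⇒≥ λ shorter →
  forAllPositionLists-elim n Γ (none shorter)
    (All.tabulate λ {(a , b)} p∈Γ → inBounds p∈Γ)
    (attractor⇒attractsUpTo L n M Γ attractor)

isGamma2D-length : ∀ {k} L n (M : Mat k) Γ → All (InBounds n) Γ → AttractsUpTo n n M Γ →
  NoAttractorShorterThan L n M (length Γ) → IsGamma2D n M (length Γ)
isGamma2D-length L n M Γ inBounds attracts none =
  (Γ , attractsUpTo⇒attractor n M Γ inBounds attracts , refl) ,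
  attractor-length-≥ L n M (length Γ) none

fromRows : ∀ {k} → Fin k → List (List (Fin k)) → Mat k
fromRows pad rows a b = fromMaybe pad (head (drop b (fromMaybe [] (head (drop a rows)))))

M₀ : Mat 2
M₀ = fromRows (# 0)
  ( (# 0 ∷ # 0 ∷ # 1 ∷ # 1 ∷ # 0 ∷ [])
  ∷ (# 1 ∷ # 1 ∷ # 1 ∷ # 0 ∷ # 1 ∷ [])
  ∷ (# 1 ∷ # 0 ∷ # 0 ∷ # 1 ∷ # 1 ∷ [])
  ∷ (# 0 ∷ # 1 ∷ # 1 ∷ # 0 ∷ # 1 ∷ [])
  ∷ (# 1 ∷ # 1 ∷ # 0 ∷ # 1 ∷ # 1 ∷ [])
  ∷ [])

γ-M₀ : IsGamma2D 5 M₀ 2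
γ-M₀ = isGamma2D-length 1 5 M₀ Γ
  (from-yes (All.all? (inBounds? 5) Γ))
  (from-yes (attractsUpTo? 5 5 M₀ Γ))
  (from-yes (noAttractorShorterThan? 1 5 M₀ 2))
  where Γ = (2 , 1) ∷ (2 , 3) ∷ []

γ-subM₀ : IsGamma2D 4 (SubMat M₀ 0 1) 3
γ-subM₀ = isGamma2D-length 2 4 (SubMat M₀ 0 1) Γ
  (from-yes (All.all? (inBounds? 4) Γ))
  (from-yes (attractsUpTo? 4 4 (SubMat M₀ 0 1) Γ))
  (from-yes (noAttractorShorterThan? 2 4 (SubMat M₀ 0 1) 3))
  where Γ = (0 , 1) ∷ (2 , 0) ∷ (2 , 2) ∷ []

lemma2 : ∃[ k ] ∃[ n ] Σ (Mat k) λ M → ∃[ i ] ∃[ j ] ∃[ ℓ ] ∃[ g ] ∃[ g' ]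
    (1 ≤ ℓ × InRange n i j ℓ × IsGamma2D n M g ×
    IsGamma2D ℓ (SubMat M i j) g' × g < g')
lemma2 = 2 , 5 , M₀ , 0 , 1 , 4 , 2 , 3 ,
  s≤s z≤n , from-yes (inRange? 5 0 1 4) , γ-M₀ , γ-subM₀ , s≤s (s≤s (s≤s z≤n))
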